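{- Let $A$ be a formula and $\Gamma$ a set of formulas. (1) If $\Gamma^{\mathsf{m}}\vdash_{\mathsf{NM}}\lnot\lnot A^{\mathsf{m}}$ (or equivalently $\Gamma^{\mathsf{m}},\lnot A^{\mathsf{m}}\vdash_{\mathsf{NM}}\bot$), then $\Gamma\vdash_{\mathsf{NK}} A$. (2) If $\Gamma^{\mathsf{j}}\vdash_{\mathsf{NJ}}\lnot\lnot A^{\mathsf{j}}$ (or equivalently $\Gamma^{\mathsf{j}},\lnot A^{\mathsf{j}}\vdash_{\mathsf{NJ}}\bot$), then $\Gamma\vdash_{\mathsf{NK}} A$.
   Context: First-order language with connectives $\top,\bot,\lnot,\land,\lor,\to$ and quantifiers $\forall,\exists$; negation $\lnot$ is primitive. Natural deduction rules: $\mathsf{raa}$ (from $\bot$ infer $A$, discharging any number, possibly zero, of assumptions $\lnot A$); $\mathsf{efq}$ (from $\bot$ infer $A$); $\top_\mathsf{i}$; $\lnot_\mathsf{i}$ (from $\bot$ infer $\lnot A$ discharging $A$); $\lnot_\mathsf{e}$ (from $\lnot A$ and $A$ infer $\bot$); and the usual Prawitz-style rules $\to_\mathsf{i}$, $\to_\mathsf{e}$, $\land_\mathsf{i}$, $\land_{\mathsf{e}_1}$, $\land_{\mathsf{e}_2}$, $\lor_{\mathsf{i}_1}$, $\lor_{\mathsf{i}_2}$, $\lor_\mathsf{e}$, $\forall_\mathsf{i}$, $\forall_\mathsf{e}$, $\exists_\mathsf{i}$, $\exists_\mathsf{e}$. $\mathsf{NM}$ is the set of all these rules except $\mathsf{raa}$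 and $\mathsf{efq}$; $\mathsf{NJ}=\mathsf{NM}\cup\{\mathsf{efq}\}$; $\mathsf{NK}=\mathsf{NM}\cup\{\mathsf{raa}\}$. $\Gamma\vdash_{\mathsf{D}} A$ means there is a derivation using only rules of $\mathsf{D}$, with conclusion $A$, all of whose undischarged assumptions are occurrences of formulas in $\Gamma$. Translations $(\cdot)^{\mathsf{m}}$ and $(\cdot)^{\mathsf{j}}$: atomic formulas, $\top$, $\bot$ unchanged; for $\ast\in\{\mathsf{m},\mathsf{j}\}$, $(A\land B)^\ast=A^\ast\land B^\ast$, $(A\lor B)^\ast=A^\ast\lor B^\ast$, $(\lnot A)^\ast=\lnot A^\ast$, $(\exists xA)^\ast=\exists xA^\ast$, $(\forall xA)^\ast=\lnot\exists x\lnot A^\ast$; $(A\to B)^{\mathsf{m}}=\lnot A^{\mathsf{m}}\lor B^{\mathsf{m}}$ and $(A\to B)^{\mathsf{j}}=A^{\mathsf{j}}\to B^{\mathsf{j}}$; $\Gamma^\ast=\{A^\ast\mid A\in\Gamma\}$. -}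

module Defs where

open import Data.Nat using (ℕ; zero; suc)
open import Data.Vec using (Vec; []; _∷_)
open import Data.List using (List; []; _∷_; map)
open import Data.List.Membership.Propositional using (_∈_)
open import Data.List.Relation.Unary.All using (All)
open import Data.Product using (Σ; _×_)
open import Relation.Binary.PropositionalEquality using (_≡_)

record Signature : Set₁ where
  field
    Func   : Set
    arityF : Func → ℕ
    Pred   : Set
    arityP : Pred → ℕ

module FOL (L : Signature) where
  open Signature L

  -- Terms; variables are de Bruijn indices.
  data Term : Set where
    var : ℕ → Term
    fun : (f : Func) → Vec Term (arityF f) → Term

  -- Formulas; ∀' and ∃' bind de Bruijn index 0.
  infixr 6 _∧'_
  infixr 5 _∨'_
  infixr 4 _⇒_
  infix 7 ¬'_
  data Formula : Set where
    atom    : (p : Pred) → Vec Term (arityP p) → Formula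
    ⊤' ⊥'   : Formula
    ¬'_     : Formula → Formula
    _∧'_ _∨'_ _⇒_ : Formula → Formula → Formula
    ∀' ∃'   : Formula → Formula

  Ren : Set
  Ren = ℕ → ℕ

  liftR : Ren → Ren
  liftR ρ zero = zero
  liftR ρ (suc n) = suc (ρ n)

  mutual
    renT : Ren → Term → Term
    renT ρ (var n) = var (ρ n)
    renT ρ (fun f ts) = fun f (renTs ρ ts)

    renTs : ∀ {k} → Ren → Vec Term k → Vec Term k
    renTs ρ [] = []
    renTs ρ (t ∷ ts) = renT ρ t ∷ renTs ρ ts

  Sub : Set
  Sub = ℕ → Term

  liftS : Sub → Sub
  liftS σ zero = var zero
  liftS σ (suc n) = renT suc (σ n)

  mutual
    subT : Sub → Term → Term
    subT σ (var n) = σ n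
    subT σ (fun f ts) = fun f (subTs σ ts)

    subTs : ∀ {k} → Sub → Vec Term k → Vec Term k
    subTs σ [] = []
    subTs σ (t ∷ ts) = subT σ t ∷ subTs σ ts

  subF : Sub → Formula → Formula
  subF σ (atom p ts) = atom p (subTs σ ts)
  subF σ ⊤' = ⊤'
  subF σ ⊥' = ⊥'
  subF σ (¬' A) = ¬' subF σ A
  subF σ (A ∧' B) = subF σ A ∧' subF σ B
  subF σ (A ∨' B) = subF σ A ∨' subF σ B
  subF σ (A ⇒ B) = subF σ A ⇒ subF σ B
  subF σ (∀' A) = ∀' (subF (liftS σ) A)
  subF σ (∃' A) = ∃' (subF (liftS σ) A)

  shift : Formula → Formula
  shift = subF (λ n → var (suc n))

  inst : Sub → Term → Sub
  inst σ t zero = t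
  inst σ t (suc n) = σ n

  _[_] : Formula → Term → Formula
  A [ t ] = subF (inst var t) A

  data System : Set where
    NM NJ NK : System

  data HasEfq : System → Set where
    efqNJ : HasEfq NJ

  data HasRaa : System → Set where
    raaNK : HasRaa NK

  -- Natural deduction in sequent presentation: Δ is the list of open
  -- (undischarged) assumptions. Discharging = removing from the context.
  -- Eigenvariable conditions are handled by de Bruijn shifting.
  infix 2 _⊢[_]_
  data _⊢[_]_ : List Formula → System → Formula → Set where
    ass  : ∀ {D Δ A} → A ∈ Δ → Δ ⊢[ D ] A
    raa  : ∀ {D Δ A} → HasRaa D → (¬' A ∷ Δ) ⊢[ D ] ⊥' → Δ ⊢[ D ] A
    efq  : ∀ {D Δ A} → HasEfq D → Δ ⊢[ D ] ⊥' → Δ ⊢[ D ] A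
    ⊤i   : ∀ {D Δ} → Δ ⊢[ D ] ⊤'
    ¬i   : ∀ {D Δ A} → (A ∷ Δ) ⊢[ D ] ⊥' → Δ ⊢[ D ] ¬' A
    ¬e   : ∀ {D Δ A} → Δ ⊢[ D ] ¬' A → Δ ⊢[ D ] A → Δ ⊢[ D ] ⊥'
    ⇒i   : ∀ {D Δ A B} → (A ∷ Δ) ⊢[ D ] B → Δ ⊢[ D ] A ⇒ B
    ⇒e   : ∀ {D Δ A B} → Δ ⊢[ D ] A ⇒ B → Δ ⊢[ D ] A → Δ ⊢[ D ] B
    ∧i   : ∀ {D Δ A B} → Δ ⊢[ D ] A → Δ ⊢[ D ] B → Δ ⊢[ D ] A ∧' B
    ∧e₁  : ∀ {D Δ A B} → Δ ⊢[ D ] A ∧' B → Δ ⊢[ D ] A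
    ∧e₂  : ∀ {D Δ A B} → Δ ⊢[ D ] A ∧' B → Δ ⊢[ D ] B
    ∨i₁  : ∀ {D Δ A B} → Δ ⊢[ D ] A → Δ ⊢[ D ] A ∨' B
    ∨i₂  : ∀ {D Δ A B} → Δ ⊢[ D ] B → Δ ⊢[ D ] A ∨' B
    ∨e   : ∀ {D Δ A B C} → Δ ⊢[ D ] A ∨' B → (A ∷ Δ) ⊢[ D ] C
           → (B ∷ Δ) ⊢[ D ] C → Δ ⊢[ D ] C
    ∀i   : ∀ {D Δ A} → map shift Δ ⊢[ D ] A → Δ ⊢[ D ] ∀' A
    ∀e   : ∀ {D Δ A} (t : Term) → Δ ⊢[ D ] ∀' A → Δ ⊢[ D ] A [ t ]
    ∃i   : ∀ {D Δ A} (t : Term) → Δ ⊢[ D ] A [ t ] → Δ ⊢[ D ] ∃' A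
    ∃e   : ∀ {D Δ A C} → Δ ⊢[ D ] ∃' A → (A ∷ map shift Δ) ⊢[ D ] shift C
           → Δ ⊢[ D ] C

  FSet : Set₁
  FSet = Formula → Set

  infix 2 _⊢⟨_⟩_
  _⊢⟨_⟩_ : FSet → System → Formula → Set
  Γ ⊢⟨ D ⟩ A = Σ (List Formula) (λ Δ → All Γ Δ × (Δ ⊢[ D ] A))

  img : (Formula → Formula) → FSet → FSet
  img tr Γ B = Σ Formula (λ C → Γ C × (B ≡ tr C))

  tm : Formula → Formula
  tm (atom p ts) = atom p ts
  tm ⊤' = ⊤'
  tm ⊥' = ⊥'
  tm (¬' A) = ¬' tm A
  tm (A ∧' B) = tm A ∧' tm B
  tm (A ∨' B) = tm A ∨' tm B
  tm (A ⇒ B) = (¬' tm A) ∨' tm B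
  tm (∀' A) = ¬' ∃' (¬' tm A)
  tm (∃' A) = ∃' (tm A)

  tj : Formula → Formula
  tj (atom p ts) = atom p ts
  tj ⊤' = ⊤'
  tj ⊥' = ⊥'
  tj (¬' A) = ¬' tj A
  tj (A ∧' B) = tj A ∧' tj B
  tj (A ∨' B) = tj A ∨' tj B
  tj (A ⇒ B) = tj A ⇒ tj B
  tj (∀' A) = ¬' ∃' (¬' tj A)
  tj (∃' A) = ∃' (tj A)

-- Classically every formula is equivalent to its m- and j-translation, so NK
-- turns a derivation of ¬¬A^* from Γ^* (in the weaker system NM or NJ) into one
-- of A from Γ: replace each assumption C^* by a derivation of it from C, and
-- eliminate the double negation.
module Submission where

open import Defs
open import Data.Product using (_×_; _,_; Σ; proj₁; proj₂; swap)
open import Data.Nat using (zero; suc)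
open import Data.Vec using (Vec; []; _∷_)
open import Data.List using (List; []; _∷_)
open import Data.List.Relation.Unary.Any using (here; there)
open import Data.List.Relation.Unary.All as All using (All; []; _∷_)
open import Data.List.Relation.Binary.Subset.Propositional using (_⊆_)
open import Data.List.Relation.Binary.Subset.Propositional.Properties
  using (map⁺; ∷⁺ʳ; xs⊆x∷xs)
open import Relation.Binary.PropositionalEquality
  using (_≡_; refl; sym; trans; cong; cong₂)

module Translations (L : Signature) where
  open FOL L

  mutual
    subT-liftS-renT-suc : ∀ σ t → subT (liftS σ) (renT suc t) ≡ renT suc (subT σ t)
    subT-liftS-renT-suc σ (var n)    = refl
    subT-liftS-renT-suc σ (fun f ts) = cong (fun f) (subTs-liftS-renTs-suc σ ts)

    subTs-liftS-renTs-suc : ∀ {k} σ (ts : Vec Term k) →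
                            subTs (liftS σ) (renTs suc ts) ≡ renTs suc (subTs σ ts)
    subTs-liftS-renTs-suc σ []       = refl
    subTs-liftS-renTs-suc σ (t ∷ ts) =
      cong₂ _∷_ (subT-liftS-renT-suc σ t) (subTs-liftS-renTs-suc σ ts)

  LeftInverse : Sub → Sub → Set
  LeftInverse σ τ = ∀ n → subT σ (τ n) ≡ var n

  liftS-leftInverse : ∀ {σ τ} → LeftInverse σ τ → LeftInverse (liftS σ) (liftS τ)
  liftS-leftInverse         inv zero    = refl
  liftS-leftInverse {σ} {τ} inv (suc n) =
    trans (subT-liftS-renT-suc σ (τ n)) (cong (renT suc) (inv n))

  mutual
    subT-leftInverse : ∀ {σ τ} → LeftInverse σ τ → ∀ t → subT σ (subT τ t) ≡ t
    subT-leftInverse inv (var n)    = inv n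
    subT-leftInverse inv (fun f ts) = cong (fun f) (subTs-leftInverse inv ts)

    subTs-leftInverse : ∀ {k σ τ} → LeftInverse σ τ →
                        (ts : Vec Term k) → subTs σ (subTs τ ts) ≡ ts
    subTs-leftInverse inv []       = refl
    subTs-leftInverse inv (t ∷ ts) =
      cong₂ _∷_ (subT-leftInverse inv t) (subTs-leftInverse inv ts)

  subF-leftInverse : ∀ {σ τ} → LeftInverse σ τ → ∀ A → subF σ (subF τ A) ≡ A
  subF-leftInverse inv (atom p ts) = cong (atom p) (subTs-leftInverse inv ts)
  subF-leftInverse inv ⊤'          = refl
  subF-leftInverse inv ⊥'          = refl
  subF-leftInverse inv (¬' A)      = cong ¬'_ (subF-leftInverse inv A)
  subF-leftInverse inv (A ∧' B)    = cong₂ _∧'_ (subF-leftInverse inv A) (subF-leftInverse inv B)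
  subF-leftInverse inv (A ∨' B)    = cong₂ _∨'_ (subF-leftInverse inv A) (subF-leftInverse inv B)
  subF-leftInverse inv (A ⇒ B)     = cong₂ _⇒_ (subF-leftInverse inv A) (subF-leftInverse inv B)
  subF-leftInverse inv (∀' A)      = cong ∀' (subF-leftInverse (liftS-leftInverse inv) A)
  subF-leftInverse inv (∃' A)      = cong ∃' (subF-leftInverse (liftS-leftInverse inv) A)

  -- Under a binder, shift leaves the bound variable 0 alone; instantiating it
  -- with var 0 afterwards undoes the shift.
  shift-under-binder-[0] : ∀ A → subF (liftS (λ n → var (suc n))) A [ var zero ] ≡ A
  shift-under-binder-[0] = subF-leftInverse inv
    where
      inv : LeftInverse (inst var (var zero)) (liftS (λ n → var (suc n)))
      inv zero    = refl
      inv (suc n) = refl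

  weaken : ∀ {D Δ Δ' B} → Δ ⊆ Δ' → Δ ⊢[ D ] B → Δ' ⊢[ D ] B
  weaken ρ (ass x)     = ass (ρ x)
  weaken ρ (raa h d)   = raa h (weaken (∷⁺ʳ _ ρ) d)
  weaken ρ (efq h d)   = efq h (weaken ρ d)
  weaken ρ ⊤i          = ⊤i
  weaken ρ (¬i d)      = ¬i (weaken (∷⁺ʳ _ ρ) d)
  weaken ρ (¬e d e)    = ¬e (weaken ρ d) (weaken ρ e)
  weaken ρ (⇒i d)      = ⇒i (weaken (∷⁺ʳ _ ρ) d)
  weaken ρ (⇒e d e)    = ⇒e (weaken ρ d) (weaken ρ e)
  weaken ρ (∧i d e)    = ∧i (weaken ρ d) (weaken ρ e)
  weaken ρ (∧e₁ d)     = ∧e₁ (weaken ρ d)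
  weaken ρ (∧e₂ d)     = ∧e₂ (weaken ρ d)
  weaken ρ (∨i₁ d)     = ∨i₁ (weaken ρ d)
  weaken ρ (∨i₂ d)     = ∨i₂ (weaken ρ d)
  weaken ρ (∨e d e f)  = ∨e (weaken ρ d) (weaken (∷⁺ʳ _ ρ) e) (weaken (∷⁺ʳ _ ρ) f)
  weaken ρ (∀i d)      = ∀i (weaken (map⁺ shift ρ) d)
  weaken ρ (∀e t d)    = ∀e t (weaken ρ d)
  weaken ρ (∃i t d)    = ∃i t (weaken ρ d)
  weaken ρ (∃e d e)    = ∃e (weaken ρ d) (weaken (∷⁺ʳ _ (map⁺ shift ρ)) e)

  cast : ∀ {D Δ A B} → A ≡ B → Δ ⊢[ D ] A → Δ ⊢[ D ] B
  cast refl d = d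

  weaken₁ : ∀ {D Δ B Y} → Δ ⊢[ D ] B → (Y ∷ Δ) ⊢[ D ] B
  weaken₁ = weaken (xs⊆x∷xs _ _)

  toNK : ∀ {D Δ B} → Δ ⊢[ D ] B → Δ ⊢[ NK ] B
  toNK (ass x)         = ass x
  toNK (raa raaNK d)   = raa raaNK (toNK d)
  -- efq is raa discharging no assumption.
  toNK (efq efqNJ d)   = raa raaNK (weaken₁ (toNK d))
  toNK ⊤i              = ⊤i
  toNK (¬i d)          = ¬i (toNK d)
  toNK (¬e d e)        = ¬e (toNK d) (toNK e)
  toNK (⇒i d)          = ⇒i (toNK d)
  toNK (⇒e d e)        = ⇒e (toNK d) (toNK e)
  toNK (∧i d e)        = ∧i (toNK d) (toNK e)
  toNK (∧e₁ d)         = ∧e₁ (toNK d)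
  toNK (∧e₂ d)         = ∧e₂ (toNK d)
  toNK (∨i₁ d)         = ∨i₁ (toNK d)
  toNK (∨i₂ d)         = ∨i₂ (toNK d)
  toNK (∨e d e f)      = ∨e (toNK d) (toNK e) (toNK f)
  toNK (∀i d)          = ∀i (toNK d)
  toNK (∀e t d)        = ∀e t (toNK d)
  toNK (∃i t d)        = ∃i t (toNK d)
  toNK (∃e d e)        = ∃e (toNK d) (toNK e)

  cut : ∀ {D Δ Θ C} → Δ ⊢[ D ] C → All (Θ ⊢[ D ]_) Δ → Θ ⊢[ D ] C
  cut d []       = weaken (λ ()) d
  cut d (e ∷ es) = ⇒e (cut (⇒i d) es) e

  infix 3 _⟶[_]_ _⟷[_]_

  _⟶[_]_ : Formula → System → Formula → Set
  A ⟶[ D ] B = ∀ {Θ} → Θ ⊢[ D ] A → Θ ⊢[ D ] B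

  _⟷[_]_ : Formula → System → Formula → Set
  A ⟷[ D ] B = (A ⟶[ D ] B) × (B ⟶[ D ] A)

  from-assumption : ∀ {D A B} → (∀ {Θ} → (A ∷ Θ) ⊢[ D ] B) → A ⟶[ D ] B
  from-assumption d e = ⇒e (⇒i d) e

  ⟷-refl : ∀ {D A} → A ⟷[ D ] A
  ⟷-refl = (λ d → d) , (λ d → d)

  ⟷-trans : ∀ {D A B C} → A ⟷[ D ] B → B ⟷[ D ] C → A ⟷[ D ] C
  ⟷-trans (f , f⁻) (g , g⁻) = (λ d → g (f d)) , (λ d → f⁻ (g⁻ d))

  ¬-mono : ∀ {D A B} → B ⟶[ D ] A → ¬' A ⟶[ D ] ¬' B
  ¬-mono f d = ¬i (¬e (weaken₁ d) (f (ass (here refl))))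

  ∧-mono : ∀ {D A A' B B'} → A ⟶[ D ] A' → B ⟶[ D ] B' → A ∧' B ⟶[ D ] A' ∧' B'
  ∧-mono f g d = ∧i (f (∧e₁ d)) (g (∧e₂ d))

  ∨-mono : ∀ {D A A' B B'} → A ⟶[ D ] A' → B ⟶[ D ] B' → A ∨' B ⟶[ D ] A' ∨' B'
  ∨-mono f g d = ∨e d (∨i₁ (f (ass (here refl)))) (∨i₂ (g (ass (here refl))))

  ⇒-mono : ∀ {D A A' B B'} → A' ⟶[ D ] A → B ⟶[ D ] B' → A ⇒ B ⟶[ D ] A' ⇒ B'
  ⇒-mono f g d = ⇒i (g (⇒e (weaken₁ d) (f (ass (here refl)))))

  ∃-mono : ∀ {D A B} → A ⟶[ D ] B → ∃' A ⟶[ D ] ∃' B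
  ∃-mono {B = B} f d =
    ∃e d (∃i (var zero) (cast (sym (shift-under-binder-[0] B))
                                           (f (ass (here refl)))))

  ¬-cong : ∀ {D A B} → A ⟷[ D ] B → ¬' A ⟷[ D ] ¬' B
  ¬-cong (f , f⁻) = ¬-mono f⁻ , ¬-mono f

  ∧-cong : ∀ {D A A' B B'} → A ⟷[ D ] A' → B ⟷[ D ] B' → A ∧' B ⟷[ D ] A' ∧' B'
  ∧-cong (f , f⁻) (g , g⁻) = ∧-mono f g , ∧-mono f⁻ g⁻

  ∨-cong : ∀ {D A A' B B'} → A ⟷[ D ] A' → B ⟷[ D ] B' → A ∨' B ⟷[ D ] A' ∨' B'
  ∨-cong (f , f⁻) (g , g⁻) = ∨-mono f g , ∨-mono f⁻ g⁻

  ⇒-cong : ∀ {D A A' B B'} → A ⟷[ D ] A' → B ⟷[ D ] B' → A ⇒ B ⟷[ D ] A' ⇒ B'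
  ⇒-cong (f , f⁻) (g , g⁻) = ⇒-mono f⁻ g , ⇒-mono f g⁻

  ∃-cong : ∀ {D A B} → A ⟷[ D ] B → ∃' A ⟷[ D ] ∃' B
  ∃-cong (f , f⁻) = ∃-mono f , ∃-mono f⁻

  ¬¬-elim : ∀ {A} → ¬' ¬' A ⟶[ NK ] A
  ¬¬-elim d = raa raaNK (¬e (weaken₁ d) (ass (here refl)))

  excluded-middle : ∀ {Θ} A → Θ ⊢[ NK ] A ∨' ¬' A
  excluded-middle A =
    raa raaNK (¬e (ass (here refl))
                  (∨i₂ (¬i (¬e (ass (there (here refl))) (∨i₁ (ass (here refl)))))))

  ⇒⟷¬∨ : ∀ {A B} → A ⇒ B ⟷[ NK ] ¬' A ∨' B
  ⇒⟷¬∨ {A} {B} = to , from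
    where
      to : A ⇒ B ⟶[ NK ] ¬' A ∨' B
      to d = ∨e (excluded-middle A)
                (∨i₂ (⇒e (weaken₁ d) (ass (here refl))))
                (∨i₁ (ass (here refl)))

      from : ¬' A ∨' B ⟶[ NK ] A ⇒ B
      from d = ⇒i (∨e (weaken₁ d)
                      (raa raaNK (weaken₁ (¬e (ass (here refl)) (ass (there (here refl))))))
                      (ass (here refl)))

  ∀⟷¬∃¬ : ∀ {A} → ∀' A ⟷[ NK ] ¬' ∃' (¬' A)
  ∀⟷¬∃¬ {A} = from-assumption to , from-assumption from
    where
      to : ∀ {Θ} → (∀' A ∷ Θ) ⊢[ NK ] ¬' ∃' (¬' A)
      to = ¬i (∃e (ass (here refl))
                  (¬e (ass (here refl))
                      (cast (shift-under-binder-[0] A)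
                            (∀e (var zero) (ass (there (there (here refl))))))))

      from : ∀ {Θ} → (¬' ∃' (¬' A) ∷ Θ) ⊢[ NK ] ∀' A
      from = ∀i (raa raaNK
                  (¬e (ass (there (here refl)))
                      (∃i (var zero) (cast (sym (cong ¬'_ (shift-under-binder-[0] A)))
                                           (ass (here refl))))))

  tm-correct : ∀ A → tm A ⟷[ NK ] A
  tm-correct (atom p ts) = ⟷-refl
  tm-correct ⊤'          = ⟷-refl
  tm-correct ⊥'          = ⟷-refl
  tm-correct (¬' A)      = ¬-cong (tm-correct A)
  tm-correct (A ∧' B)    = ∧-cong (tm-correct A) (tm-correct B)
  tm-correct (A ∨' B)    = ∨-cong (tm-correct A) (tm-correct B)
  tm-correct (A ⇒ B)     = ⟷-trans (∨-cong (¬-cong (tm-correct A)) (tm-correct B)) (swap ⇒⟷¬∨)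
  tm-correct (∀' A)      = ⟷-trans (¬-cong (∃-cong (¬-cong (tm-correct A)))) (swap ∀⟷¬∃¬)
  tm-correct (∃' A)      = ∃-cong (tm-correct A)

  tj-correct : ∀ A → tj A ⟷[ NK ] A
  tj-correct (atom p ts) = ⟷-refl
  tj-correct ⊤'          = ⟷-refl
  tj-correct ⊥'          = ⟷-refl
  tj-correct (¬' A)      = ¬-cong (tj-correct A)
  tj-correct (A ∧' B)    = ∧-cong (tj-correct A) (tj-correct B)
  tj-correct (A ∨' B)    = ∨-cong (tj-correct A) (tj-correct B)
  tj-correct (A ⇒ B)     = ⇒-cong (tj-correct A) (tj-correct B)
  tj-correct (∀' A)      = ⟷-trans (¬-cong (∃-cong (¬-cong (tj-correct A)))) (swap ∀⟷¬∃¬)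
  tj-correct (∃' A)      = ∃-cong (tj-correct A)

  img-assumptions : ∀ {tr Γ Δ} → (∀ C → C ⟶[ NK ] tr C) → All (img tr Γ) Δ →
                    Σ (List Formula) λ Δ' → All Γ Δ' × All (Δ' ⊢[ NK ]_) Δ
  img-assumptions to-tr []                   = [] , [] , []
  img-assumptions to-tr ((C , γ , refl) ∷ as) =
    let (Δ' , γs , ds) = img-assumptions to-tr as
    in  C ∷ Δ' , γ ∷ γs , to-tr C (ass (here refl)) ∷ All.map weaken₁ ds

  img-⊢ : ∀ {D tr Γ B} → (∀ C → C ⟶[ NK ] tr C) → img tr Γ ⊢⟨ D ⟩ B → Γ ⊢⟨ NK ⟩ B
  img-⊢ to-tr (Δ , as , d) =
    let (Δ' , γs , ds) = img-assumptions to-tr as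
    in  Δ' , γs , cut (toNK d) ds

  ¬¬-translation-reflects : ∀ {D tr Γ A} → (∀ C → tr C ⟷[ NK ] C) →
                            img tr Γ ⊢⟨ D ⟩ ¬' ¬' tr A → Γ ⊢⟨ NK ⟩ A
  ¬¬-translation-reflects {A = A} correct p =
    let (Δ , γs , d) = img-⊢ (λ C → proj₂ (correct C)) p
    in  Δ , γs , proj₁ (correct A) (¬¬-elim d)

proposition6p7 : (L : Signature) → let open FOL L in
    (Γ : FSet) (A : Formula) →
      ((img tm Γ ⊢⟨ NM ⟩ ¬' ¬' tm A) → (Γ ⊢⟨ NK ⟩ A))
    × ((img tj Γ ⊢⟨ NJ ⟩ ¬' ¬' tj A) → (Γ ⊢⟨ NK ⟩ A))
proposition6p7 L Γ A =
  ¬¬-translation-reflects tm-correct , ¬¬-translation-reflects tj-correct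
  where open Translations L
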